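{- Let $(X_a:a\in A)$ be sets in a matroid $M$ with $\bigcup_{a\in A}X_a=E(M)$. Then the collection of flats $F$ of $M$ for which $(X_a:a\in A)$ is skew in $M/\!\!/F$ is a modular cut of $M$.
   Context: Matroids are possibly infinite (in the sense of Bruhn, Diestel, Kriesell, Pendavingh and Wollan). For $F\subseteq E(M)$, the projection $M/\!\!/F=(M/F)\oplus O_F$, where $O_F$ is the rank-zero matroid on $F$; it has ground set $E(M)$ and the same independent sets as $M/F$. An independent set $B$ is a mutual basis for an indexed family $(X_a)$ if $B\cap X_a$ is a basis (maximal independent subset) of $X_a$ for all $a$; the family is modular if it has a mutual basis; a pair is modular if the two-member family is. A family $(X_a)$ is skew if it is modular and $X_a\cap X_b\subseteq\mathrm{cl}(\varnothing)$ for all distinct $a,b$. A chain is a family of sets totally ordered by inclusion. A modular cut of $M$ is a collection $\mathcal{F}$ of flats of $M$ such that (i) every flat containing a member of $\mathcal{F}$ is in $\mathcal{F}$; (ii) $F\cap F'\in\mathcal{F}$ whenever $F,F'\in\mathcal{F}$ and $(F,F')$ is a modular pair; (iii) $\bigcap\mathcal{C}\in\mathcal{F}$ for every infinite chain $\mathcal{C}\subseteq\mathcal{F}$ that is a modular family. -}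

module Defs where

open import Level using (0ℓ; Level; _⊔_) renaming (suc to lsuc)
open import Data.Bool using (Bool; true; false)
open import Data.Empty using (⊥)
open import Data.Product using (Σ; Σ-syntax; ∃; ∃-syntax; _×_; _,_; proj₁)
open import Data.List using (List)
open import Data.List.Relation.Unary.Any using (Any)
open import Relation.Nullary using (¬_)
open import Relation.Binary.PropositionalEquality using (_≡_)
open import Relation.Unary using (Pred; _⊆_; _∪_; _∩_; ∅; ｛_｝; _≐_)

Subset : Set → Set₁
Subset E = Pred E 0ℓ

Maximal : {E : Set} → Pred (Subset E) (lsuc 0ℓ) → Subset E → Set₁
Maximal P I = P I × (∀ J → P J → I ⊆ J → J ⊆ I)

-- Matroids in the sense of Bruhn–Diestel–Kriesell–Pendavingh–Wollan,
-- via the independence axioms (I1), (I2), (I3), (IM).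
record Matroid (E : Set) : Set₂ where
  field
    Indep : Pred (Subset E) (lsuc 0ℓ)
    I1 : Indep ∅
    I2 : ∀ I J → J ⊆ I → Indep I → Indep J
    I3 : ∀ I I' → Indep I → ¬ Maximal Indep I → Maximal Indep I' →
         Σ[ x ∈ E ] (I' x × ¬ I x × Indep (I ∪ ｛ x ｝))
    IM : ∀ I (X : Subset E) → Indep I → I ⊆ X →
         Σ[ J ∈ Subset E ] Maximal (λ K → Indep K × I ⊆ K × K ⊆ X) J

open Matroid public

-- Notions depending only on an independence predicate on subsets of E
-- (so they apply both to M and to the projection M//F).
IndepPred : Set → Set₂
IndepPred E = Pred (Subset E) (lsuc 0ℓ)

IsBasis : {E : Set} → IndepPred E → Subset E → Subset E → Set₁
IsBasis Ind X B = Maximal (λ K → Ind K × K ⊆ X) B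

cl : {E : Set} → IndepPred E → Subset E → E → Set₁
cl Ind X e = X e ⊎' (Σ[ I ∈ Subset _ ] (I ⊆ X × Ind I × ¬ Ind (I ∪ ｛ e ｝)))
  where
  open import Data.Sum using () renaming (_⊎_ to _⊎'_)

IsFlat : {E : Set} → Matroid E → Subset E → Set₁
IsFlat M F = ∀ e → cl (Indep M) F e → F e

-- Independent sets of M//F = (M/F) ⊕ O_F : the I ⊆ E ∖ F with I ∪ B_F
-- independent in M for a basis B_F of F.
ProjIndep : {E : Set} → Matroid E → Subset E → IndepPred E
ProjIndep M F I = (∀ e → I e → ¬ F e) ×
                  Σ[ B ∈ Subset _ ] (IsBasis (Indep M) F B × Indep M (I ∪ B))

IsMutualBasis : {a : Level} {E : Set} {A : Set a} → IndepPred E → (A → Subset E) → Subset E → Set (lsuc 0ℓ ⊔ a)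
IsMutualBasis Ind X B = Ind B × (∀ a → IsBasis Ind (X a) (B ∩ X a))

Modular : {a : Level} {E : Set} {A : Set a} → IndepPred E → (A → Subset E) → Set (lsuc 0ℓ ⊔ a)
Modular Ind X = Σ[ B ∈ Subset _ ] IsMutualBasis Ind X B

pair : {E : Set} → Subset E → Subset E → Bool → Subset E
pair X Y true = X
pair X Y false = Y

ModularPair : {E : Set} → IndepPred E → Subset E → Subset E → Set₁
ModularPair Ind X Y = Modular Ind (pair X Y)

Skew : {E A : Set} → IndepPred E → (A → Subset E) → Set₁
Skew {A = A} Ind X =
  Modular Ind X × (∀ (a b : A) → ¬ a ≡ b → ∀ e → X a e → X b e → cl Ind ∅ e)

IsChain : {E : Set} → Pred (Subset E) (lsuc 0ℓ) → Set₁
IsChain 𝒞 = ∀ X Y → 𝒞 X → 𝒞 Y → (X ⊆ Y) ⊎' (Y ⊆ X)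
  where
  open import Data.Sum using () renaming (_⊎_ to _⊎'_)

IsFinite : {E : Set} → Pred (Subset E) (lsuc 0ℓ) → Set₁
IsFinite 𝒞 = Σ[ L ∈ List (Subset _) ] (∀ X → 𝒞 X → Any (λ Y → X ≐ Y) L)

Infinite : {E : Set} → Pred (Subset E) (lsuc 0ℓ) → Set₁
Infinite 𝒞 = ¬ IsFinite 𝒞

-- Z is the intersection of the collection 𝒞 (stated extensionally to
-- avoid a universe bump).
IsIntersection : {E : Set} → Pred (Subset E) (lsuc 0ℓ) → Subset E → Set₁
IsIntersection 𝒞 Z = ∀ e → (Z e → ∀ X → 𝒞 X → X e) × ((∀ X → 𝒞 X → X e) → Z e)

members : {E : Set} → (𝒞 : Pred (Subset E) (lsuc 0ℓ)) → Σ (Subset E) 𝒞 → Subset E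
members 𝒞 = proj₁

record IsModularCut {E : Set} (M : Matroid E) (𝓕 : Pred (Subset E) (lsuc 0ℓ)) : Set₂ where
  field
    flats : ∀ F → 𝓕 F → IsFlat M F
    upClosed : ∀ F F' → 𝓕 F → IsFlat M F' → F ⊆ F' → 𝓕 F'
    modPair : ∀ F F' → 𝓕 F → 𝓕 F' → ModularPair (Indep M) F F' → 𝓕 (F ∩ F')
    infChain : ∀ (𝒞 : Pred (Subset E) (lsuc 0ℓ)) → (∀ X → 𝒞 X → 𝓕 X) →
               IsChain 𝒞 → Infinite 𝒞 → Modular (Indep M) (members 𝒞) →
               ∀ Z → IsIntersection 𝒞 Z → 𝓕 Z

{-# OPTIONS --safe #-}
-- For a flat H, the family (X a) is skew in M//H as soon as some base K of M meets H in a basis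
-- of H, spans each X a by K ∩ (H ∪ X a), and the X a overlap only inside H: then K ∖ H is a mutual
-- basis in M//H.  Conversely, if the X a cover E and are skew in M//H, every base K meeting H in a
-- basis has this spanning property.  Given members F t of the collection with a mutual basis,
-- extend it to a base K.  For subsets of the independent set K, closure commutes with
-- intersection; hence K meets G = ⋂ F t in a basis of G, and the spanning property passes from
-- the F t to G.  For upward closure, take K adapted to both F ⊆ F'.
module Submission where

open import Defs
open import Level using (0ℓ; Level; lift; lower) renaming (suc to lsuc)
open import Axiom.ExcludedMiddle using (ExcludedMiddle)
open import Data.Bool using (true; false)
open import Data.Empty using (⊥; ⊥-elim)
open import Data.List using ([])
open import Data.Product using (_×_; ∃-syntax; Σ; Σ-syntax; _,_; proj₁; proj₂)
open import Data.Sum using (inj₁; inj₂)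
open import Relation.Nullary using (Dec; yes; no; ¬_)
open import Relation.Nullary.Decidable.Core using (map′; decidable-stable)
open import Relation.Binary.PropositionalEquality using (_≢_; refl)
open import Relation.Unary using (Pred; _⊆_; _∪_; _∩_; _∖_; ∁; ∅; ｛_｝; U; ⋂)

module Classical (em : ExcludedMiddle (lsuc 0ℓ)) where

  dec : (P : Set) → Dec P
  dec P = map′ lower lift em

  ¬¬-elim : {P : Set₁} → ¬ ¬ P → P
  ¬¬-elim = decidable-stable em

  ¬¬-elim₀ : {P : Set} → ¬ ¬ P → P
  ¬¬-elim₀ = decidable-stable (dec _)

  infinite⇒inhabited : {E : Set} {𝒞 : Pred (Subset E) (lsuc 0ℓ)} → Infinite 𝒞 → Σ (Subset E) 𝒞
  infinite⇒inhabited infinite =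
    ¬¬-elim λ empty → infinite ([] , λ C C∈𝒞 → ⊥-elim (empty (C , C∈𝒞)))

basis-maximal : {E : Set} {Ind : IndepPred E} {X B : Subset E} {x : E} →
                IsBasis Ind X B → X x → Ind (B ∪ ｛ x ｝) → B x
basis-maximal ((_ , B⊆X) , maximal) Xx ind =
  maximal _ (ind , λ { (inj₁ Be) → B⊆X Be ; (inj₂ refl) → Xx }) inj₁ (inj₂ refl)

module MatroidFacts (em : ExcludedMiddle (lsuc 0ℓ)) {E : Set} (M : Matroid E) where
  open Classical em

  Ind : IndepPred E
  Ind = Indep M

  Cl : Subset E → Pred E (lsuc 0ℓ)
  Cl = cl Ind

  Base : Subset E → Set₁
  Base = Maximal Ind

  Basis : Subset E → Subset E → Set₁
  Basis = IsBasis Ind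

  private variable
    B F I I' J K Q₁ Q₂ S W X Y Z : Subset E
    x y : E
    ℓ : Level

  indep-⊆ : Ind I → J ⊆ I → Ind J
  indep-⊆ {I} {J} iI J⊆I = I2 M I J J⊆I iI

  extend-to-basis : Ind I → I ⊆ X → Σ[ J ∈ Subset E ] (Basis X J × I ⊆ J)
  extend-to-basis {I} {X} iI I⊆X with IM M I X iI I⊆X
  ... | J , (iJ , I⊆J , J⊆X) , maximal =
    J , ((iJ , J⊆X) , λ J' (iJ' , J'⊆X) J⊆J' → maximal J' (iJ' , (λ Ie → J⊆J' (I⊆J Ie)) , J'⊆X) J⊆J')
      , I⊆J

  extend-to-base : Ind I → Σ[ K ∈ Subset E ] (Base K × I ⊆ K)
  extend-to-base iI with extend-to-basis {X = U} iI _
  ... | K , ((iK , _) , maximal) , I⊆K = K , (iK , λ J iJ K⊆J → maximal J (iJ , _) K⊆J) , I⊆K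

  basis-exists : ∀ X → Σ[ B ∈ Subset E ] Basis X B
  basis-exists X with extend-to-basis {X = X} (I1 M) (λ ())
  ... | B , B-basis , _ = B , B-basis

  cl-mono : Y ⊆ Z → Cl Y ⊆ Cl Z
  cl-mono Y⊆Z (inj₁ Yx) = inj₁ (Y⊆Z Yx)
  cl-mono Y⊆Z (inj₂ (I , I⊆Y , iI , dep)) = inj₂ (I , (λ Ie → Y⊆Z (I⊆Y Ie)) , iI , dep)

  cl-intro : Ind Y → (Ind (Y ∪ ｛ x ｝) → Y x) → Cl Y x
  cl-intro {Y} {x} iY absorb with em {Ind (Y ∪ ｛ x ｝)}
  ... | yes ind = inj₁ (absorb ind)
  ... | no dep = inj₂ (Y , (λ Ye → Ye) , iY , dep)

  ∉cl⇒indep : Ind Y → ¬ Cl Y x → Ind (Y ∪ ｛ x ｝)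
  ∉cl⇒indep iY x∉cl = ¬¬-elim λ dep → x∉cl (inj₂ (_ , (λ Ye → Ye) , iY , dep))

  cl-∉⇒dependent : Cl Z x → ¬ Z x → ¬ Ind (Z ∪ ｛ x ｝)
  cl-∉⇒dependent (inj₁ Zx) ¬Zx _ = ¬Zx Zx
  cl-∉⇒dependent (inj₂ (I , I⊆Z , _ , dep)) _ ind =
    dep (indep-⊆ ind λ { (inj₁ Ie) → inj₁ (I⊆Z Ie) ; (inj₂ refl) → inj₂ refl })

  basis-spans : Basis X B → X ⊆ Cl B
  basis-spans B-basis@((iB , _) , _) Xx = cl-intro iB (basis-maximal B-basis Xx)

  base-spans : Base K → Cl K x
  base-spans (iK , maximal) = cl-intro iK λ ind → maximal _ ind inj₁ (inj₂ refl)

  spanning-indep⇒basis : Ind B → B ⊆ X → X ⊆ Cl B → Basis X B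
  spanning-indep⇒basis iB B⊆X X⊆clB = (iB , B⊆X) , λ J (iJ , J⊆X) B⊆J {x} Jx →
    ¬¬-elim₀ λ ¬Bx → cl-∉⇒dependent (X⊆clB (J⊆X Jx)) ¬Bx
                       (indep-⊆ iJ λ { (inj₁ Be) → B⊆J Be ; (inj₂ refl) → Jx })

  indep-∩-⊆-basis : Basis X B → Ind K → B ⊆ K → K ∩ X ⊆ B
  indep-∩-⊆-basis B-basis iK B⊆K (Kx , Xx) =
    basis-maximal B-basis Xx (indep-⊆ iK λ { (inj₁ Be) → B⊆K Be ; (inj₂ refl) → Kx })

  ∩-basis : Basis X B → Ind K → B ⊆ K → Basis X (K ∩ X)
  ∩-basis ((_ , B⊆X) , maximal) iK B⊆K = (indep-⊆ iK proj₁ , proj₂) , λ J (iJ , J⊆X) K∩X⊆J Jx →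
    B⊆K (maximal J (iJ , J⊆X) (λ Be → K∩X⊆J (B⊆K Be , B⊆X Be)) Jx) , J⊆X Jx

  unaugmentable⇒base : Ind J → Base B → (∀ {x} → B x → ¬ J x → ¬ Ind (J ∪ ｛ x ｝)) → Base J
  unaugmentable⇒base {J} {B} iJ B-base stuck = ¬¬-elim λ ¬base →
    let (_ , Bx , ¬Jx , ind) = I3 M J B iJ ¬base B-base in stuck Bx ¬Jx ind

  basis-⊇-base⇒base : Basis S J → Base B → B ⊆ S → Base J
  basis-⊇-base⇒base J-basis@((iJ , _) , _) B-base B⊆S =
    unaugmentable⇒base iJ B-base λ Bx ¬Jx ind → ¬Jx (basis-maximal J-basis (B⊆S Bx) ind)

  base-∖-⊆-reverse : Basis X I' → Base B → I' ⊆ B → Base K → K ∖ X ⊆ B → B ∖ X ⊆ K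
  base-∖-⊆-reverse {X} {I'} {B} {K} I'-basis@((_ , I'⊆X) , _) (iB , _) I'⊆B K-base K∖X⊆B
    with extend-to-basis {X = I' ∪ K} (indep-⊆ iB λ { (inj₁ I'e) → I'⊆B I'e ; (inj₂ e) → K∖X⊆B e })
                                       (λ { (inj₁ I'e) → inj₁ I'e ; (inj₂ (Ke , _)) → inj₂ Ke })
  ... | P , P-basis@((iP , P⊆I'∪K) , _) , ⊆P = λ (Bt , ¬Xt) → outside-I' ¬Xt (P⊆I'∪K (B⊆P Bt))
    where
    outside-I' : ¬ X x → (I' ∪ K) x → K x
    outside-I' ¬Xx (inj₁ I'x) = ⊥-elim (¬Xx (I'⊆X I'x))
    outside-I' ¬Xx (inj₂ Kx) = Kx
    P⊆B : P ⊆ B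
    P⊆B {p} Pp with dec (X p)
    ... | yes Xp = I'⊆B (indep-∩-⊆-basis I'-basis iP (λ I'e → ⊆P (inj₁ I'e)) (Pp , Xp))
    ... | no ¬Xp = K∖X⊆B (outside-I' ¬Xp (P⊆I'∪K Pp) , ¬Xp)
    B⊆P : B ⊆ P
    B⊆P = proj₂ (basis-⊇-base⇒base P-basis K-base inj₂) B iB P⊆B

  -- If no x ∈ I' augments I, extend I' to a base B.  The maximal independent sets containing I
  -- inside I ∪ (B ∖ X) and containing I ∪ {y} inside I ∪ {y} ∪ (B ∖ X) are then both bases, the
  -- first contained in the second; so they coincide, which puts y in I ∪ (B ∖ X).
  augment-within : Basis X I' → Ind (I ∪ ｛ y ｝) → I ⊆ X → X y → ¬ I y →
                   Σ[ x ∈ E ] (I' x × ¬ I x × Ind (I ∪ ｛ x ｝))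
  augment-within {X} {I'} {I} {y} I'-basis@((iI' , _) , _) iIy I⊆X Xy ¬Iy =
    ¬¬-elim λ ¬aug → stuck⇒⊥ (λ I'x ¬Ix ind → ¬aug (_ , I'x , ¬Ix , ind)) (extend-to-base iI')
    where
    stuck⇒⊥ : (∀ {x} → I' x → ¬ I x → ¬ Ind (I ∪ ｛ x ｝)) →
              Σ[ B ∈ Subset E ] (Base B × I' ⊆ B) → ⊥
    stuck⇒⊥ stuck (B , B-base@(iB , _) , I'⊆B)
      with extend-to-basis {X = (I ∪ ｛ y ｝) ∪ (B ∖ X)} iIy inj₁
         | extend-to-basis {X = I ∪ (B ∖ X)} (indep-⊆ iIy inj₁) inj₁
    ... | K , K-basis@((iK , K⊆) , _) , Iy⊆K | L , L-basis@((_ , L⊆) , _) , I⊆L =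
      y∉I∪B∖X (L⊆ (K⊆L (Iy⊆K (inj₂ refl))))
      where
      y∉I∪B∖X : ¬ (I ∪ (B ∖ X)) y
      y∉I∪B∖X (inj₁ Iy) = ¬Iy Iy
      y∉I∪B∖X (inj₂ (_ , ¬Xy)) = ¬Xy Xy
      ⊇I-basis⇒base : Basis S J → I ⊆ J → B ∖ X ⊆ S → Base J
      ⊇I-basis⇒base {S} {J} J-basis@((iJ , _) , _) I⊆J B∖X⊆S = unaugmentable⇒base iJ B-base unaugmentable
        where
        unaugmentable : ∀ {x} → B x → ¬ J x → ¬ Ind (J ∪ ｛ x ｝)
        unaugmentable {x} Bx ¬Jx ind with dec (X x)
        ... | yes Xx = stuck (indep-∩-⊆-basis I'-basis iB I'⊆B (Bx , Xx)) (λ Ix → ¬Jx (I⊆J Ix))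
                             (indep-⊆ ind λ { (inj₁ Ie) → inj₁ (I⊆J Ie) ; (inj₂ e) → inj₂ e })
        ... | no ¬Xx = ¬Jx (basis-maximal J-basis (B∖X⊆S (Bx , ¬Xx)) ind)
      K∖X⊆B : K ∖ X ⊆ B
      K∖X⊆B (Kk , ¬Xk) with K⊆ Kk
      ... | inj₁ (inj₁ Ik) = ⊥-elim (¬Xk (I⊆X Ik))
      ... | inj₁ (inj₂ refl) = ⊥-elim (¬Xk Xy)
      ... | inj₂ (Bk , _) = Bk
      B∖X⊆K : B ∖ X ⊆ K
      B∖X⊆K = base-∖-⊆-reverse I'-basis B-base I'⊆B
                (⊇I-basis⇒base K-basis (λ Ie → Iy⊆K (inj₁ Ie)) inj₂) K∖X⊆B
      L⊆K : L ⊆ K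
      L⊆K Ll with L⊆ Ll
      ... | inj₁ Il = Iy⊆K (inj₁ Il)
      ... | inj₂ t = B∖X⊆K t
      K⊆L : K ⊆ L
      K⊆L = proj₂ (⊇I-basis⇒base L-basis I⊆L inj₂) K iK L⊆K

  cl-trans : Ind Z → Y ⊆ Cl Z → Cl Y ⊆ Cl Z
  cl-trans iZ Y⊆clZ (inj₁ Yx) = Y⊆clZ Yx
  cl-trans {Z} {Y} iZ Y⊆clZ {x} (inj₂ (J , J⊆Y , iJ , dep)) = cl-intro iZ λ iZx → ¬¬-elim₀ (¬¬Zx iZx)
    where
    ¬¬Zx : Ind (Z ∪ ｛ x ｝) → ¬ ¬ Z x
    ¬¬Zx iZx ¬Zx with extend-to-basis {X = (Z ∪ J) ∪ ｛ x ｝} iJ (λ Je → inj₁ (inj₂ Je))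
    ... | J' , J'-basis@((iJ' , J'⊆) , _) , J⊆J'
      with augment-within J'-basis iZx (λ Ze → inj₁ (inj₁ Ze)) (inj₂ refl) ¬Zx
    ... | z , J'z , ¬Zz , iZz with J'⊆ J'z
    ... | inj₁ (inj₁ Zz) = ¬Zz Zz
    ... | inj₁ (inj₂ Jz) = cl-∉⇒dependent (Y⊆clZ (J⊆Y Jz)) ¬Zz iZz
    ... | inj₂ refl = dep (indep-⊆ iJ' λ { (inj₁ Je) → J⊆J' Je ; (inj₂ refl) → J'z })

  indep-∪-change-basis : Basis Y Q₁ → Basis Y Q₂ → I ⊆ ∁ Y → Ind (I ∪ Q₁) → Ind (I ∪ Q₂)
  indep-∪-change-basis {Y} {Q₁} {Q₂} {I} Q₁-basis@((_ , Q₁⊆Y) , _) ((iQ₂ , Q₂⊆Y) , _) I⊆∁Y iIQ₁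
    with extend-to-basis {X = I ∪ Q₂} iQ₂ inj₂
  ... | J , J-basis@((iJ , J⊆) , _) , Q₂⊆J =
    indep-⊆ iJ λ { (inj₁ Ie) → I⊆J Ie ; (inj₂ Qe) → Q₂⊆J Qe }
    where
    iS : Ind ((J ∩ I) ∪ Q₁)
    iS = indep-⊆ iIQ₁ λ { (inj₁ (_ , Ie)) → inj₁ Ie ; (inj₂ Qe) → inj₂ Qe }
    J⊆clS : J ⊆ Cl ((J ∩ I) ∪ Q₁)
    J⊆clS Je with J⊆ Je
    ... | inj₁ Ie = inj₁ (inj₁ (Je , Ie))
    ... | inj₂ Qe = cl-mono inj₂ (basis-spans Q₁-basis (Q₂⊆Y Qe))
    I⊆J : I ⊆ J
    I⊆J {i} Ii = ¬¬-elim₀ λ ¬Ji →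
      cl-∉⇒dependent (cl-trans iS J⊆clS (basis-spans J-basis (inj₁ Ii)))
                     (λ { (inj₁ (Ji , _)) → ¬Ji Ji ; (inj₂ Q₁i) → I⊆∁Y Ii (Q₁⊆Y Q₁i) })
                     (indep-⊆ iIQ₁ λ { (inj₁ (inj₁ (_ , Ie))) → inj₁ Ie ; (inj₁ (inj₂ Qe)) → inj₂ Qe
                                     ; (inj₂ refl) → inj₁ Ii })

  indep-⊉-dependent : Ind J → ¬ Ind (K ∪ Y) → Y ⊆ J → Σ[ b ∈ E ] (K b × ¬ J b)
  indep-⊉-dependent iJ dep Y⊆J = ¬¬-elim₀ λ K⊆J →
    dep (indep-⊆ iJ λ { (inj₁ Kb) → ¬¬-elim₀ (λ ¬Jb → K⊆J (_ , Kb , ¬Jb)) ; (inj₂ Yb) → Y⊆J Yb })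

  exchange : Ind K → W ⊆ K → Ind (W ∪ ｛ x ｝) → ¬ Ind (K ∪ ｛ x ｝) →
             Σ[ b ∈ E ] (K b × ¬ W b × Ind ((K ∖ ｛ b ｝) ∪ ｛ x ｝))
  exchange {K} {W} {x} iK W⊆K iWx dep
    with extend-to-basis {X = K ∪ ｛ x ｝} iWx (λ { (inj₁ We) → inj₁ (W⊆K We) ; (inj₂ e) → inj₂ e })
  ... | Kₘ , Kₘ-basis@((iKₘ , Kₘ⊆) , _) , Wx⊆Kₘ
    with indep-⊉-dependent iKₘ dep (λ { refl → Wx⊆Kₘ (inj₂ refl) })
  ... | b , Kb , ¬Kₘb
    with augment-within Kₘ-basis (indep-⊆ iK λ { (inj₁ (Ke , _)) → Ke ; (inj₂ refl) → Kb })
                        (λ (Ke , _) → inj₁ Ke) (inj₁ Kb) (λ (_ , b≢b) → b≢b refl)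
  ... | z , Kₘz , z∉K∖b , ind with Kₘ⊆ Kₘz
  ... | inj₂ refl = b , Kb , (λ Wb → ¬Kₘb (Wx⊆Kₘ (inj₁ Wb))) , ind
  ... | inj₁ Kz = ⊥-elim (z∉K∖b (Kz , λ { refl → ¬Kₘb Kₘz }))

  cl-⋂-indep : {T : Set ℓ} → Ind K → T → (Y : T → Subset E) → (∀ t → Y t ⊆ K) → W ⊆ K →
               K ∩ ⋂ T Y ⊆ W → ⋂ T (λ t → Cl (Y t)) ⊆ Cl W
  cl-⋂-indep {K = K} {W = W} iK t₀ Y Y⊆K W⊆K K∩⋂Y⊆W {x} clY with dec (K x)
  ... | yes Kx = inj₁ (K∩⋂Y⊆W (Kx , λ t → ¬¬-elim₀ λ ¬Ytx →
          cl-∉⇒dependent (clY t) ¬Ytx (indep-⊆ iK λ { (inj₁ Ye) → Y⊆K t Ye ; (inj₂ refl) → Kx })))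
  -- Exchanging x for some b ∈ K ∖ W leaves some Y t ⊆ K ∖ {b}, which still spans x.
  ... | no ¬Kx = cl-intro (indep-⊆ iK W⊆K) λ iWx →
    let (b , Kb , ¬Wb , ind) = exchange iK W⊆K iWx (cl-∉⇒dependent (cl-mono (Y⊆K t₀) (clY t₀)) ¬Kx)
    in ⊥-elim (¬Wb (K∩⋂Y⊆W (Kb , λ t → ¬¬-elim₀ λ ¬Ytb →
         cl-∉⇒dependent (cl-mono (λ Ye → Y⊆K t Ye , λ { refl → ¬Ytb Ye }) (clY t))
                        (λ (Kx , _) → ¬Kx Kx) ind)))

  Ind// : Subset E → IndepPred E
  Ind// F = ProjIndep M F

  loop//⇒∈ : IsFlat M F → cl (Ind// F) ∅ ⊆ F
  loop//⇒∈ F-flat (inj₁ ())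
  loop//⇒∈ {F} F-flat {x} (inj₂ (I , I⊆∅ , _ , dep)) with basis-exists F
  ... | B , B-basis@((iB , B⊆F) , _) = ¬¬-elim₀ λ ¬Fx →
    dep ( (λ { _ (inj₁ Ie) _ → I⊆∅ Ie ; _ (inj₂ refl) Fe → ¬Fx Fe })
        , B , B-basis
        , indep-⊆ (∉cl⇒indep iB λ clBx → ¬Fx (F-flat x (cl-mono B⊆F clBx)))
                  (λ { (inj₁ (inj₁ Ie)) → ⊥-elim (I⊆∅ Ie) ; (inj₁ (inj₂ e)) → inj₂ e
                     ; (inj₂ Be) → inj₁ Be }))

  ∈⇒loop// : F ⊆ cl (Ind// F) ∅
  ∈⇒loop// {F} {x} Fx with basis-exists F
  ... | B , B-basis@((iB , _) , _) =
    inj₂ ( ∅ , (λ ()) , ((λ _ ()) , B , B-basis , indep-⊆ iB λ { (inj₁ ()) ; (inj₂ Be) → Be })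
         , λ (∅x⊆∁F , _) → ∅x⊆∁F x (inj₂ refl) Fx)

  indep//⇒∪-basis-indep : Ind// F J → Basis F B → Ind (J ∪ B)
  indep//⇒∪-basis-indep (J⊆∁F , _ , B'-basis , iJB') B-basis =
    indep-∪-change-basis B'-basis B-basis (λ {e} → J⊆∁F e) iJB'

  basis//-∪-basis-spans : IsBasis (Ind// F) Z J → Basis F B → Z ⊆ Cl (J ∪ B)
  basis//-∪-basis-spans {F} J-basis@((iJ@(J⊆∁F , _) , _) , _) B-basis {z} Zz with dec (F z)
  ... | yes Fz = cl-mono inj₂ (basis-spans B-basis Fz)
  ... | no ¬Fz = cl-intro (indep//⇒∪-basis-indep iJ B-basis) λ ind → inj₁ (basis-maximal J-basis Zz
        ( (λ { e (inj₁ Je) → J⊆∁F e Je ; _ (inj₂ refl) → ¬Fz })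
        , _ , B-basis
        , indep-⊆ ind λ { (inj₁ (inj₁ Je)) → inj₁ (inj₁ Je) ; (inj₁ (inj₂ e)) → inj₂ e
                        ; (inj₂ Be) → inj₁ (inj₂ Be) }))

  basis//-∪-basis : IsBasis (Ind// F) Z J → Basis F B → Basis (Z ∪ F) (J ∪ B)
  basis//-∪-basis J-basis@((iJ , J⊆Z) , _) B-basis@((_ , B⊆F) , _) =
    spanning-indep⇒basis (indep//⇒∪-basis-indep iJ B-basis)
      (λ { (inj₁ Je) → inj₁ (J⊆Z Je) ; (inj₂ Be) → inj₂ (B⊆F Be) })
      (λ { (inj₁ Ze) → basis//-∪-basis-spans J-basis B-basis Ze
         ; (inj₂ Fe) → cl-mono inj₂ (basis-spans B-basis Fe) })

module SkewFamily (em : ExcludedMiddle (lsuc 0ℓ)) {E : Set} (M : Matroid E)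
                  {A : Set} (X : A → Subset E) (cover : ∀ e → ∃[ a ] X a e) where
  open Classical em
  open MatroidFacts em M

  private variable
    F F' G H K : Subset E
    ℓ : Level

  𝓕 : Pred (Subset E) (lsuc 0ℓ)
  𝓕 F = IsFlat M F × Skew (Ind// F) X

  Overlaps⊆ : Subset E → Set
  Overlaps⊆ F = ∀ {a b} → a ≢ b → X a ∩ X b ⊆ F

  skew//⇒overlaps⊆ : IsFlat M H → Skew (Ind// H) X → Overlaps⊆ H
  skew//⇒overlaps⊆ H-flat (_ , loops) a≢b (Xae , Xbe) = loop//⇒∈ H-flat (loops _ _ a≢b _ Xae Xbe)

  skew//-from-base : Base K → Basis H (K ∩ H) → (∀ a → X a ⊆ Cl (K ∩ (H ∪ X a))) → Overlaps⊆ H →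
                     Skew (Ind// H) X
  skew//-from-base {K} {H} (iK , _) KH-basis spans overlaps =
    (K ∖ H , indep// (λ e → e) , basis//) , λ a b a≢b e Xae Xbe → ∈⇒loop// (overlaps a≢b (Xae , Xbe))
    where
    indep// : {J : Subset E} → J ⊆ K ∖ H → Ind// H J
    indep// J⊆K∖H = (λ e Je → proj₂ (J⊆K∖H Je)) , K ∩ H , KH-basis
                  , indep-⊆ iK λ { (inj₁ Je) → proj₁ (J⊆K∖H Je) ; (inj₂ (Ke , _)) → Ke }
    basis// : ∀ a → IsBasis (Ind// H) (X a) ((K ∖ H) ∩ X a)
    basis// a = (indep// proj₁ , proj₂) , maximal
      where
      maximal : ∀ J → Ind// H J × J ⊆ X a → (K ∖ H) ∩ X a ⊆ J → J ⊆ (K ∖ H) ∩ X a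
      maximal J (iJ@(J⊆∁H , _) , J⊆Xa) ⊆J {x} Jx = (Kx , J⊆∁H x Jx) , J⊆Xa Jx
        where
        spanner⊆ : K ∩ (H ∪ X a) ⊆ J ∪ (K ∩ H)
        spanner⊆ {k} (Kk , H∪Xak) with dec (H k) | H∪Xak
        ... | yes Hk | _ = inj₂ (Kk , Hk)
        ... | no ¬Hk | inj₁ Hk = ⊥-elim (¬Hk Hk)
        ... | no ¬Hk | inj₂ Xak = inj₁ (⊆J ((Kk , ¬Hk) , Xak))
        Kx : K x
        Kx = ¬¬-elim₀ λ ¬Kx → cl-∉⇒dependent (spans a (J⊆Xa Jx)) (λ (Kx , _) → ¬Kx Kx)
               (indep-⊆ (indep//⇒∪-basis-indep iJ KH-basis)
                        λ { (inj₁ e) → spanner⊆ e ; (inj₂ refl) → inj₁ Jx })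

  -- If x ∉ cl (K ∩ (H ∪ X a)), then K ∩ (H ∪ X a) + x extends, through the mutual basis B, to an
  -- independent R + x, although R spans K and hence x.
  skew//⇒spans : IsFlat M H → Skew (Ind// H) X → Base K → Basis H (K ∩ H) →
                 ∀ a → X a ⊆ Cl (K ∩ (H ∪ X a))
  skew//⇒spans {H} {K} H-flat H-skew@((B , iB@(B⊆∁H , _) , B-bases) , _) K-base@(iK , _) KH-basis
               a {x} Xax =
    ¬¬-elim λ x∉clY → let iRx = R∪x-indep x∉clY in
      cl-∉⇒dependent (cl-trans (indep-⊆ iRx inj₁) K⊆clR (base-spans K-base))
                     (λ { (inj₁ Yx) → x∉clY (inj₁ Yx) ; (inj₂ (_ , ¬Xax)) → ¬Xax Xax }) iRx
    where
    Y R : Subset E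
    Y = K ∩ (H ∪ X a)
    R = Y ∪ (B ∖ X a)
    iY : Ind Y
    iY = indep-⊆ iK proj₁
    Y∪x⊆ : Y ∪ ｛ x ｝ ⊆ X a ∪ H
    Y∪x⊆ (inj₁ (_ , inj₁ He)) = inj₂ He
    Y∪x⊆ (inj₁ (_ , inj₂ Xae)) = inj₁ Xae
    Y∪x⊆ (inj₂ refl) = inj₁ Xax
    B∖Xa⊆∁ : B ∖ X a ⊆ ∁ (X a ∪ H)
    B∖Xa⊆∁ (_ , ¬Xae) (inj₁ Xae) = ¬Xae Xae
    B∖Xa⊆∁ (Be , _) (inj₂ He) = B⊆∁H _ Be He
    iB∖Xa∪Q₀ : Ind ((B ∖ X a) ∪ ((B ∩ X a) ∪ (K ∩ H)))
    iB∖Xa∪Q₀ = indep-⊆ (indep//⇒∪-basis-indep iB KH-basis)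
      λ { (inj₁ (Be , _)) → inj₁ Be ; (inj₂ (inj₁ (Be , _))) → inj₁ Be ; (inj₂ (inj₂ e)) → inj₂ e }
    R∪x-indep : ¬ Cl Y x → Ind (R ∪ ｛ x ｝)
    R∪x-indep x∉clY with extend-to-basis (∉cl⇒indep iY x∉clY) Y∪x⊆
    ... | Q , Q-basis , Y∪x⊆Q =
      indep-⊆ (indep-∪-change-basis (basis//-∪-basis (B-bases a) KH-basis) Q-basis B∖Xa⊆∁ iB∖Xa∪Q₀)
        λ { (inj₁ (inj₁ Ye)) → inj₂ (Y∪x⊆Q (inj₁ Ye)) ; (inj₁ (inj₂ e)) → inj₁ e
          ; (inj₂ refl) → inj₂ (Y∪x⊆Q (inj₂ refl)) }
    K⊆clR : K ⊆ Cl R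
    K⊆clR {k} Kk with dec (X a k) | cover k
    ... | yes Xak | _ = inj₁ (inj₁ (Kk , inj₂ Xak))
    ... | no ¬Xak | b , Xbk = cl-mono ⊆R (basis//-∪-basis-spans (B-bases b) KH-basis Xbk)
      where
      ⊆R : (B ∩ X b) ∪ (K ∩ H) ⊆ R
      ⊆R (inj₁ (Be , Xbe)) = inj₂ (Be , λ Xae → B⊆∁H _ Be
                               (skew//⇒overlaps⊆ H-flat H-skew (λ { refl → ¬Xak Xbk }) (Xae , Xbe)))
      ⊆R (inj₂ (Ke , He)) = inj₁ (Ke , inj₁ He)

  upward-closed : F ⊆ F' → IsFlat M F' → 𝓕 F → 𝓕 F'
  upward-closed {F} {F'} F⊆F' F'-flat (F-flat , F-skew) with basis-exists F
  ... | BF , BF-basis@((iBF , BF⊆F) , _) with extend-to-basis {X = F'} iBF (λ e → F⊆F' (BF⊆F e))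
  ... | BF' , BF'-basis@((iBF' , _) , _) , BF⊆BF' with extend-to-base iBF'
  ... | K , K-base@(iK , _) , BF'⊆K =
    F'-flat , skew//-from-base K-base (∩-basis BF'-basis iK BF'⊆K) spans
                (λ a≢b e → F⊆F' (skew//⇒overlaps⊆ F-flat F-skew a≢b e))
    where
    spans : ∀ a → X a ⊆ Cl (K ∩ (F' ∪ X a))
    spans a Xax = cl-mono (λ { (Ke , inj₁ Fe) → Ke , inj₁ (F⊆F' Fe) ; (Ke , inj₂ Xae) → Ke , inj₂ Xae })
      (skew//⇒spans F-flat F-skew K-base (∩-basis BF-basis iK λ e → BF'⊆K (BF⊆BF' e)) a Xax)

  ⋂-closed : {T : Set ℓ} → T → (F : T → Subset E) → (∀ t → 𝓕 (F t)) → Modular Ind F →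
             (∀ t → G ⊆ F t) → ⋂ T F ⊆ G → 𝓕 G
  ⋂-closed {G = G} {T = T} t₀ F F∈𝓕 (B₀ , iB₀ , B₀-bases) G⊆F ⋂F⊆G with extend-to-base iB₀
  ... | K , K-base@(iK , _) , B₀⊆K = G-flat , skew//-from-base K-base KG-basis spans overlaps
    where
    KF-basis : ∀ t → Basis (F t) (K ∩ F t)
    KF-basis t = ∩-basis (B₀-bases t) iK λ e → B₀⊆K (proj₁ e)
    G-flat : IsFlat M G
    G-flat x clGx = ⋂F⊆G λ t → proj₁ (F∈𝓕 t) x (cl-mono (G⊆F t) clGx)
    KG-basis : Basis G (K ∩ G)
    KG-basis = spanning-indep⇒basis (indep-⊆ iK proj₁) proj₂ λ Gx →
      cl-⋂-indep iK t₀ (λ t → K ∩ F t) (λ _ → proj₁) proj₁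
                 (λ (Kx , KFx) → Kx , ⋂F⊆G λ t → proj₂ (KFx t))
                 λ t → basis-spans (KF-basis t) (G⊆F t Gx)
    spans : ∀ a → X a ⊆ Cl (K ∩ (G ∪ X a))
    spans a Xax = cl-⋂-indep iK t₀ (λ t → K ∩ (F t ∪ X a)) (λ _ → proj₁) proj₁ meet
                    λ t → skew//⇒spans (proj₁ (F∈𝓕 t)) (proj₂ (F∈𝓕 t)) K-base (KF-basis t) a Xax
      where
      meet : K ∩ ⋂ T (λ t → K ∩ (F t ∪ X a)) ⊆ K ∩ (G ∪ X a)
      meet {e} (Ke , in-all) with dec (X a e)
      ... | yes Xae = Ke , inj₂ Xae
      ... | no ¬Xae = Ke , inj₁ (⋂F⊆G λ t → in-F t (proj₂ (in-all t)))
        where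
        in-F : ∀ t → (F t ∪ X a) e → F t e
        in-F t (inj₁ Fe) = Fe
        in-F t (inj₂ Xae) = ⊥-elim (¬Xae Xae)
    overlaps : Overlaps⊆ G
    overlaps a≢b e = ⋂F⊆G λ t → skew//⇒overlaps⊆ (proj₁ (F∈𝓕 t)) (proj₂ (F∈𝓕 t)) a≢b e

mainTheorem13 : ExcludedMiddle (lsuc 0ℓ) →
    {E A : Set} (M : Matroid E) (X : A → Subset E) →
    (∀ e → ∃[ a ] X a e) →
    IsModularCut M (λ F → IsFlat M F × Skew (ProjIndep M F) X)
mainTheorem13 em M X cover = record
  { flats = λ _ → proj₁
  ; upClosed = λ F F' F∈𝓕 F'-flat F⊆F' → upward-closed F⊆F' F'-flat F∈𝓕
  ; modPair = λ F F' F∈𝓕 F'∈𝓕 modular →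
      ⋂-closed true (pair F F') (λ { true → F∈𝓕 ; false → F'∈𝓕 }) modular
               (λ { true → proj₁ ; false → proj₂ }) (λ Fx → Fx true , Fx false)
  ; infChain = λ 𝒞 ⊆𝓕 _ infinite modular Z Z-⋂ →
      ⋂-closed (infinite⇒inhabited infinite) (members 𝒞) (λ (C , C∈𝒞) → ⊆𝓕 C C∈𝒞) modular
               (λ (C , C∈𝒞) Ze → proj₁ (Z-⋂ _) Ze C C∈𝒞)
               (λ Ce → proj₂ (Z-⋂ _) λ C C∈𝒞 → Ce (C , C∈𝒞))
  }
  where
  open Classical em
  open SkewFamily em M X cover
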